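{- For all integers $n \geq 1$ and $1 \leq k \leq n$, the FiboNarayana number \[ N_{n,k,F} = \frac{1}{F_n} \binom{n}{k}_F \binom{n}{k-1}_F \] is a positive integer.
   Context: $F_n$ denotes the Fibonacci numbers: $F_0 = 0$, $F_1 = 1$, $F_n = F_{n-1} + F_{n-2}$ for $n \geq 2$. Write $F_n! = F_n F_{n-1} \cdots F_2 F_1$, with $F_0! = 1$. The fibonomial coefficient is $\binom{n}{k}_F = \frac{F_n!}{F_k!\,F_{n-k}!}$ for $0 \leq k \leq n$. -}

module Defs where

open import Data.Nat using (ℕ; zero; suc; _+_; _*_)

F : ℕ → ℕ
F zero = 0
F (suc zero) = 1
F (suc (suc n)) = F (suc n) + F n

F! : ℕ → ℕ
F! zero = 1
F! (suc n) = F (suc n) * F! n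

-- Write n = j + m + 1 and k = j + 1.  Clearing denominators, N_{n,k,F} equals
-- F_n · C(n−1, k−1)² / (F_k F_{n−k+1}), where C is the fibonomial coefficient.
-- The addition formula F_n = F_k F_{n−k+1} + F_{k−1} F_{n−k} splits this into
-- C(n−1, k−1)² + C(n−1, k−2) · C(n−1, k), a sum of products of fibonomial
-- coefficients, which are natural numbers by their Pascal-type recurrence.
module Submission where

open import Defs
open import Data.Nat using (ℕ; _+_; _*_; _∸_; _≤_; _<_; zero; suc; z≤n; s≤s)
open import Data.Nat.Properties using (+-identityʳ; *-zeroʳ; *-identityˡ; *-identityʳ; *-distribʳ-+; ≤-trans; m≤m+n; *-mono-≤; +-suc; +-comm; m+n∸m≡n; m≤n⇒∃[o]m+o≡n)
open import Data.Nat.Tactic.RingSolver using (solve-∀)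
open import Data.Product using (∃-syntax; _×_; _,_)
open import Relation.Binary.PropositionalEquality using (_≡_; refl; sym; trans; cong; cong₂; subst; module ≡-Reasoning)

F-+ : ∀ m n → F (suc (m + n)) ≡ F (suc m) * F (suc n) + F m * F n
F-+ zero n = base (F (suc n)) (F n)
  where
  base : ∀ x y → x ≡ 1 * x + 0 * y
  base = solve-∀
F-+ (suc zero) n = base (F (suc n)) (F n)
  where
  base : ∀ x y → x + y ≡ 1 * x + 1 * y
  base = solve-∀
F-+ (suc (suc m)) n = begin
    F (suc (suc m + n)) + F (suc (m + n))
  ≡⟨ cong₂ _+_ (F-+ (suc m) n) (F-+ m n) ⟩
    (F (suc (suc m)) * F (suc n) + F (suc m) * F n) + (F (suc m) * F (suc n) + F m * F n)
  ≡⟨ regroup (F (suc (suc m))) (F (suc m)) (F m) (F (suc n)) (F n) ⟩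
    F (suc (suc (suc m))) * F (suc n) + F (suc (suc m)) * F n
  ∎
  where
  open ≡-Reasoning
  regroup : ∀ a b c x y → (a * x + b * y) + (b * x + c * y) ≡ (a + b) * x + (b + c) * y
  regroup = solve-∀

F-pos : ∀ n → 0 < F (suc n)
F-pos zero = s≤s z≤n
F-pos (suc n) = ≤-trans (F-pos n) (m≤m+n (F (suc n)) (F n))

F!-pos : ∀ n → 0 < F! n
F!-pos zero = s≤s z≤n
F!-pos (suc n) = *-mono-≤ (F-pos n) (F!-pos n)

-- fibonomial a b is the fibonomial coefficient C(a + b, a), given by the
-- recurrence C(n, k) = F_{k+1} C(n−1, k) + F_{n−k−1} C(n−1, k−1).
fibonomial : ℕ → ℕ → ℕ
fibonomial zero b = 1
fibonomial (suc a) zero = 1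
fibonomial (suc a) (suc b) = F (suc (suc a)) * fibonomial (suc a) b + F b * fibonomial a (suc b)

fibonomial-*-F! : ∀ a b → fibonomial a b * F! a * F! b ≡ F! (a + b)
fibonomial-*-F! zero b = +-identityʳ (F! b)
fibonomial-*-F! (suc a) zero rewrite +-identityʳ a = trans (*-identityʳ (1 * F! (suc a))) (*-identityˡ (F! (suc a)))
fibonomial-*-F! (suc a) (suc b) = begin
    (F (suc (suc a)) * fibonomial (suc a) b + F b * fibonomial a (suc b)) * (F (suc a) * F! a) * (F (suc b) * F! b)
  ≡⟨ regroup (F (suc (suc a))) (fibonomial (suc a) b) (F b) (fibonomial a (suc b)) (F (suc a)) (F! a) (F (suc b)) (F! b) ⟩
    F (suc (suc a)) * F (suc b) * (fibonomial (suc a) b * F! (suc a) * F! b)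
      + F (suc a) * F b * (fibonomial a (suc b) * F! a * F! (suc b))
  ≡⟨ cong₂ (λ u v → F (suc (suc a)) * F (suc b) * u + F (suc a) * F b * v)
       (fibonomial-*-F! (suc a) b) (trans (fibonomial-*-F! a (suc b)) (cong F! (+-suc a b))) ⟩
    F (suc (suc a)) * F (suc b) * F! (suc a + b) + F (suc a) * F b * F! (suc a + b)
  ≡⟨ sym (*-distribʳ-+ (F! (suc a + b)) (F (suc (suc a)) * F (suc b)) (F (suc a) * F b)) ⟩
    (F (suc (suc a)) * F (suc b) + F (suc a) * F b) * F! (suc a + b)
  ≡⟨ cong (_* F! (suc a + b)) (sym (F-+ (suc a) b)) ⟩
    F! (suc (suc a + b))
  ≡⟨ cong F! (sym (+-suc (suc a) b)) ⟩
    F! (suc a + suc b)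
  ∎
  where
  open ≡-Reasoning
  regroup : ∀ p c q d r x s y →
    (p * c + q * d) * (r * x) * (s * y) ≡ p * s * (c * (r * x) * y) + r * q * (d * x * (s * y))
  regroup = solve-∀

-- C(j + m, j + 1) · C(j + m, j − 1), read as 0 when j = 0 or m = 0.
adjacentFibonomials : ℕ → ℕ → ℕ
adjacentFibonomials (suc j) (suc m) = fibonomial (suc (suc j)) m * fibonomial j (suc (suc m))
adjacentFibonomials _ _ = 0

fibonomial²-*-F! : ∀ j m →
  fibonomial j m * fibonomial j m * (F! (suc j) * F! m * (F! j * F! (suc m)))
    ≡ F! (j + m) * F! (j + m) * F (suc j) * F (suc m)
fibonomial²-*-F! j m = begin
    fibonomial j m * fibonomial j m * (F (suc j) * F! j * F! m * (F! j * (F (suc m) * F! m)))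
  ≡⟨ regroup (fibonomial j m) (F (suc j)) (F! j) (F! m) (F (suc m)) ⟩
    (fibonomial j m * F! j * F! m) * (fibonomial j m * F! j * F! m) * F (suc j) * F (suc m)
  ≡⟨ cong (λ u → u * u * F (suc j) * F (suc m)) (fibonomial-*-F! j m) ⟩
    F! (j + m) * F! (j + m) * F (suc j) * F (suc m)
  ∎
  where
  open ≡-Reasoning
  regroup : ∀ c p x y q →
    c * c * (p * x * y * (x * (q * y))) ≡ (c * x * y) * (c * x * y) * p * q
  regroup = solve-∀

adjacentFibonomials-*-F! : ∀ j m →
  adjacentFibonomials j m * (F! (suc j) * F! m * (F! j * F! (suc m)))
    ≡ F! (j + m) * F! (j + m) * F j * F m
adjacentFibonomials-*-F! zero m = sym (cong (_* F m) (*-zeroʳ (F! m * F! m)))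
adjacentFibonomials-*-F! (suc j) zero = sym (*-zeroʳ (F! (suc j + 0) * F! (suc j + 0) * F (suc j)))
adjacentFibonomials-*-F! (suc j) (suc m) = begin
    c₁ * c₂ * (F! (suc (suc j)) * (F (suc m) * F! m) * (F (suc j) * F! j * F! (suc (suc m))))
  ≡⟨ regroup c₁ c₂ (F! (suc (suc j))) (F (suc m)) (F! m) (F (suc j)) (F! j) (F! (suc (suc m))) ⟩
    (c₁ * F! (suc (suc j)) * F! m) * (c₂ * F! j * F! (suc (suc m))) * F (suc j) * F (suc m)
  ≡⟨ cong₂ (λ u v → u * v * F (suc j) * F (suc m))
       (fibonomial-*-F! (suc (suc j)) m) (fibonomial-*-F! j (suc (suc m))) ⟩
    F! (suc (suc j) + m) * F! (j + suc (suc m)) * F (suc j) * F (suc m)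
  ≡⟨ cong₂ (λ u v → F! u * F! v * F (suc j) * F (suc m)) (sym (+-suc (suc j) m)) (+-suc j (suc m)) ⟩
    F! (suc j + suc m) * F! (suc (j + suc m)) * F (suc j) * F (suc m)
  ∎
  where
  open ≡-Reasoning
  c₁ = fibonomial (suc (suc j)) m
  c₂ = fibonomial j (suc (suc m))
  regroup : ∀ c d x q y p z w →
    c * d * (x * (q * y) * (p * z * w)) ≡ (c * x * y) * (d * z * w) * p * q
  regroup = solve-∀

-- N_{j+m+1, j+1, F}
fiboNarayana : ℕ → ℕ → ℕ
fiboNarayana j m = fibonomial j m * fibonomial j m + adjacentFibonomials j m

fiboNarayana-*-F! : ∀ j m →
  fiboNarayana j m * (F (suc j + m) * (F! (suc j) * F! m) * (F! j * F! (suc m)))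
    ≡ F! (suc j + m) * F! (suc j + m)
fiboNarayana-*-F! j m = begin
    (c * c + a) * (Fn * (F! (suc j) * F! m) * (F! j * F! (suc m)))
  ≡⟨ distribute (c * c) a Fn (F! (suc j) * F! m) (F! j * F! (suc m)) ⟩
    Fn * (c * c * D + a * D)
  ≡⟨ cong₂ (λ u v → Fn * (u + v)) (fibonomial²-*-F! j m) (adjacentFibonomials-*-F! j m) ⟩
    Fn * (P * P * F (suc j) * F (suc m) + P * P * F j * F m)
  ≡⟨ factor Fn P (F (suc j)) (F (suc m)) (F j) (F m) ⟩
    Fn * (P * P) * (F (suc j) * F (suc m) + F j * F m)
  ≡⟨ cong (Fn * (P * P) *_) (sym (F-+ j m)) ⟩
    Fn * (P * P) * Fn
  ≡⟨ square Fn P ⟩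
    (Fn * P) * (Fn * P)
  ∎
  where
  open ≡-Reasoning
  c = fibonomial j m
  a = adjacentFibonomials j m
  Fn = F (suc (j + m))
  P = F! (j + m)
  D = F! (suc j) * F! m * (F! j * F! (suc m))
  distribute : ∀ s t f x y → (s + t) * (f * x * y) ≡ f * (s * (x * y) + t * (x * y))
  distribute = solve-∀
  factor : ∀ f p w x y z → f * (p * p * w * x + p * p * y * z) ≡ f * (p * p) * (w * x + y * z)
  factor = solve-∀
  square : ∀ f p → f * (p * p) * f ≡ (f * p) * (f * p)
  square = solve-∀

m*n>0⇒m>0 : ∀ m {n} → 0 < m * n → 0 < m
m*n>0⇒m>0 zero ()
m*n>0⇒m>0 (suc m) _ = s≤s z≤n

fiboNarayana-pos : ∀ j m → 0 < fiboNarayana j m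
fiboNarayana-pos j m = m*n>0⇒m>0 (fiboNarayana j m)
  (subst (0 <_) (sym (fiboNarayana-*-F! j m)) (*-mono-≤ (F!-pos (suc j + m)) (F!-pos (suc j + m))))

mainTheorem3 : (n k : ℕ) → 1 ≤ n → 1 ≤ k → k ≤ n →
    ∃[ N ] (0 < N ×
      N * (F n * (F! k * F! (n ∸ k)) * (F! (k ∸ 1) * F! (n ∸ k + 1)))
        ≡ F! n * F! n)
mainTheorem3 n (suc j) _ _ k≤n with m≤n⇒∃[o]m+o≡n k≤n
... | m , refl rewrite m+n∸m≡n (suc j) m | +-comm m 1 =
  fiboNarayana j m , fiboNarayana-pos j m , fiboNarayana-*-F! j m
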